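{- For all integers $r\ge 3$ and $n_1\ge\dots\ge n_r\ge 2$, $$\iota_0(r-2,n_1,\dots,n_r) = n_1+\dots+n_r - r + 1.$$
   Context: For $1\le \ell\le r$ let $X_\ell=\{1,\dots,n_\ell\}$. For $A=(a_1,\dots,a_r),B=(b_1,\dots,b_r)\in X_1\times\dots\times X_r$, let $A\cap B=\{\ell\in[r]: a_\ell=b_\ell\}$. A family $\mathcal{F}\subseteq X_1\times\dots\times X_r$ is $t$-intersecting if $|A\cap B|\ge t$ for all $A,B\in\mathcal{F}$. Let $\bigcap\mathcal{F}$ be the set of indices $\ell\in[r]$ such that all members of $\mathcal{F}$ have the same $\ell$-th coordinate. For integers $r>t\ge1$ and $n_1\ge\dots\ge n_r\ge 2$, $\iota_0(t,n_1,\dots,n_r)$ is the maximum size of a $t$-intersecting family $\mathcal{F}\subseteq X_1\times\dots\times X_r$ with $|\bigcap\mathcal{F}|<t$. -}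

module Defs where

open import Data.Nat using (ℕ; _≤_; _<_; _∸_; _+_)
open import Data.Fin using (Fin)
open import Data.Fin.Properties using (_≟_)
open import Data.List using (List; length; filter; allFin; map)
open import Data.Nat.ListAction using (sum)
open import Data.List.Relation.Unary.All using (All; all?)
open import Data.List.Relation.Unary.AllPairs using (AllPairs)
open import Data.List.Membership.Propositional using (_∈_)
open import Data.Product using (Σ; _×_)
open import Relation.Binary.PropositionalEquality using (_≡_)
open import Relation.Nullary using (¬_)

-- The product space X_1 × ... × X_r with X_ℓ = Fin (n ℓ) (0-based {0,…,n_ℓ-1}).
Tuple : (r : ℕ) → (Fin r → ℕ) → Set
Tuple r n = (ℓ : Fin r) → Fin (n ℓ)

_≗ᵗ_ : ∀ {r n} → Tuple r n → Tuple r n → Set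
_≗ᵗ_ {r} A B = ∀ ℓ → A ℓ ≡ B ℓ

-- |A ∩ B| = number of coordinates on which A and B agree
agree : ∀ {r n} → Tuple r n → Tuple r n → ℕ
agree {r} A B = length (filter (λ ℓ → A ℓ ≟ B ℓ) (allFin r))

-- A family is a duplicate-free list of tuples (size = length)
Family : (r : ℕ) → (Fin r → ℕ) → Set
Family r n = List (Tuple r n)

NoDup : ∀ {r n} → Family r n → Set
NoDup F = AllPairs (λ A B → ¬ (A ≗ᵗ B)) F

TIntersecting : ∀ {r n} → ℕ → Family r n → Set
TIntersecting t F = ∀ {A B} → A ∈ F → B ∈ F → t ≤ agree A B

-- |⋂ F| : number of coordinates ℓ on which all members of F agree
kernelSize : ∀ {r n} → Family r n → ℕ
kernelSize {r} F =
  length (filter (λ ℓ → all? (λ A → all? (λ B → A ℓ ≟ B ℓ) F) F) (allFin r))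

Admissible : ∀ {r n} → ℕ → Family r n → Set
Admissible t F = NoDup F × TIntersecting t F × kernelSize F < t

-- ι₀(t, n_1, …, n_r) = N : N is the maximum size of an admissible family
IsIota0 : (t r : ℕ) → (Fin r → ℕ) → ℕ → Set
IsIota0 t r n N =
  Σ (Family r n) (λ F → Admissible t F × length F ≡ N)
  × (∀ (F : Family r n) → Admissible t F → length F ≤ N)

sumFin : ∀ {r} → (Fin r → ℕ) → ℕ
sumFin {r} n = sum (map n (allFin r))

{-# OPTIONS --safe #-}
-- An (r-2)-intersecting family is a set of Hamming diameter at most two in
-- X₁ × ⋯ × X_r. The Hamming ball of radius one around any point is such a family,
-- has empty kernel (as every n_ℓ ≥ 2), and has 1 + Σ (n_ℓ - 1) elements.
-- Conversely, let F be admissible and A ∈ F. Unless F lies in the ball around A,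
-- some B ∈ F differs from A in two coordinates i, j, and since the kernel is
-- small some W ∈ F moves a third coordinate k. Among A, B, W one finds a point P
-- with members of F adjacent to P in three distinct directions (a tripod). A
-- member of F outside the ball around P must differ from P in all three
-- directions; this determines it, and rules out P ∈ F. Exchanging it for P
-- therefore embeds F into the ball around P.
module Submission where

open import Defs
open import Data.Nat using (ℕ; _≤_; _∸_; _+_)
open import Data.Fin using (Fin)
import Data.Fin as F

open import Algebra.Properties.CommutativeSemigroup using (x∙yz≈y∙xz)
open import Data.Empty using (⊥-elim)
open import Data.Fin using (punchIn; fromℕ<)
open import Data.Fin.Properties using (_≟_; punchIn-injective; punchInᵢ≢i; punchIn-punchOut)
import Data.Fin.Properties as FinP
open import Data.List using (List; []; _∷_; length; filter; allFin; map; concat; tabulate; _++_)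
open import Data.List.Membership.Propositional using (_∈_; lose; find)
open import Data.List.Membership.Propositional.Properties
  using (∈-allFin; ∈-filter⁺; ∈-tabulate⁺; ∈-tabulate⁻; ∈-map⁺; ∈-concat⁺′)
import Data.List.Membership.Setoid as SetoidMembership
import Data.List.Membership.Setoid.Properties as SetoidMembershipP
open import Data.List.Properties
  using (length-tabulate; length-map; length-++; length-removeAt′; filter-all; filter-none)
import Data.List.Relation.Binary.Disjoint.Setoid as DisjointS
open import Data.List.Relation.Binary.Subset.Propositional using (_⊆_)
open import Data.List.Relation.Unary.All using (All; _∷_)
import Data.List.Relation.Unary.All as All
open import Data.List.Relation.Unary.All.Properties using (all-filter)
import Data.List.Relation.Unary.All.Properties as AllP
open import Data.List.Relation.Unary.AllPairs using (AllPairs; _∷_)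
import Data.List.Relation.Unary.AllPairs.Properties as AllPairsP
open import Data.List.Relation.Unary.Any using (here; there; _─_; index)
import Data.List.Relation.Unary.Any as Any
import Data.List.Relation.Unary.Any.Properties as AnyP
open import Data.List.Relation.Unary.Unique.Propositional using (Unique)
open import Data.List.Relation.Unary.Unique.Propositional.Properties using (allFin⁺; filter⁺; tabulate⁺)
import Data.List.Relation.Unary.Unique.Setoid as UniqueS
import Data.List.Relation.Unary.Unique.Setoid.Properties as UniqueSP
open import Data.Nat using (suc; z≤n; s≤s; _<_)
open import Data.Nat.ListAction using (sum)
open import Data.Nat.Properties
  using ( +-comm; +-commutativeSemigroup; m+n∸m≡n; m∸n≤m; m≤n+o⇒m∸n≤o; ∸-monoˡ-≤; <⇒≱; ≤⇒≯
        ; module ≤-Reasoning)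
open import Data.Product using (∃-syntax; ∃₂; _×_; _,_; proj₁; proj₂)
open import Data.Sum using (_⊎_; inj₁; inj₂)
open import Function using (_∘_; id)
open import Relation.Binary using (Setoid)
open import Relation.Binary.PropositionalEquality
  using (_≡_; _≢_; refl; sym; trans; cong; cong₂; subst; ≢-sym; module ≡-Reasoning)
import Relation.Binary.PropositionalEquality as ≡
open import Relation.Nullary using (¬_; Dec; yes; no; ¬?)
open import Relation.Nullary.Decidable using (_×-dec_; decidable-stable)
open import Relation.Unary using (Pred; Decidable)

module _ {a ℓ} (S : Setoid a ℓ) where
  open Setoid S using (_≈_) renaming (Carrier to A; trans to ≈-trans; sym to ≈-sym)
  open SetoidMembership S using () renaming (_∈_ to _∈ₛ_)
  open UniqueS S using () renaming (Unique to Uniqueₛ)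

  ∈-─⁺ : ∀ {x y ys} (x∈ys : x ∈ₛ ys) → y ∈ₛ ys → ¬ x ≈ y → y ∈ₛ (ys ─ x∈ys)
  ∈-─⁺ (here x≈z)   (here y≈z)   x≉y = ⊥-elim (x≉y (≈-trans x≈z (≈-sym y≈z)))
  ∈-─⁺ (here _)     (there y∈ys) _   = y∈ys
  ∈-─⁺ (there _)    (here y≈z)   _   = here y≈z
  ∈-─⁺ (there x∈ys) (there y∈ys) x≉y = there (∈-─⁺ x∈ys y∈ys x≉y)

  injective-on⇒length-≤ : ∀ (f : A → A) {xs ys} → Uniqueₛ xs →
    (∀ {x y} → x ∈ xs → y ∈ xs → f x ≈ f y → x ≈ y) →
    (∀ {x} → x ∈ xs → f x ∈ₛ ys) → length xs ≤ length ys
  injective-on⇒length-≤ f {[]} _ _ _ = z≤n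
  injective-on⇒length-≤ f {x ∷ xs} {ys} (x≉xs ∷ xs-unique) inj maps = begin
    suc (length xs)           ≤⟨ s≤s (injective-on⇒length-≤ f xs-unique inj′ maps′) ⟩
    suc (length (ys ─ fx∈ys)) ≡⟨ ≡.sym (length-removeAt′ ys (index fx∈ys)) ⟩
    length ys                 ∎
    where
    open ≤-Reasoning
    fx∈ys : f x ∈ₛ ys
    fx∈ys = maps (here refl)
    inj′ : ∀ {y z} → y ∈ xs → z ∈ xs → f y ≈ f z → y ≈ z
    inj′ y∈xs z∈xs = inj (there y∈xs) (there z∈xs)
    maps′ : ∀ {y} → y ∈ xs → f y ∈ₛ (ys ─ fx∈ys)
    maps′ y∈xs = ∈-─⁺ fx∈ys (maps (there y∈xs)) (All.lookup x≉xs y∈xs ∘ inj (here refl) (there y∈xs))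

unique-⊆⇒length-≤ : ∀ {a} {A : Set a} {xs ys : List A} → Unique xs → xs ⊆ ys → length xs ≤ length ys
unique-⊆⇒length-≤ {A = A} xs-unique =
  injective-on⇒length-≤ (≡.setoid A) id xs-unique (λ _ _ x≡y → x≡y)

length-allFin : ∀ r → length (allFin r) ≡ r
length-allFin r = length-tabulate id

count : ∀ {r p} {P : Pred (Fin r) p} → Decidable P → ℕ
count {r} P? = length (filter P? (allFin r))

module _ {r : ℕ} {p} {P : Pred (Fin r) p} (P? : Decidable P) where

  three-failures⇒3+count≤r : ∀ {u v w} → u ≢ v → u ≢ w → v ≢ w → ¬ P u → ¬ P v → ¬ P w →
                             3 + count P? ≤ r
  three-failures⇒3+count≤r {u} {v} {w} u≢v u≢w v≢w ¬Pu ¬Pv ¬Pw =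
    subst (3 + count P? ≤_) (length-allFin r) (unique-⊆⇒length-≤ distinct (λ {x} _ → ∈-allFin x))
    where
    outside : ∀ {x} → ¬ P x → All (x ≢_) (filter P? (allFin r))
    outside ¬Px = All.map (λ Py x≡y → ¬Px (subst P (sym x≡y) Py)) (all-filter P? (allFin r))
    distinct : Unique (u ∷ v ∷ w ∷ filter P? (allFin r))
    distinct = (u≢v ∷ u≢w ∷ outside ¬Pu) ∷ (v≢w ∷ outside ¬Pv) ∷ outside ¬Pw
             ∷ filter⁺ P? (allFin⁺ r)

  holds-off-two⇒r∸2≤count : ∀ i j → (∀ ℓ → ℓ ≢ i → ℓ ≢ j → P ℓ) → r ∸ 2 ≤ count P?
  holds-off-two⇒r∸2≤count i j holds = m≤n+o⇒m∸n≤o r 2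
    (subst (_≤ 2 + count P?) (length-allFin r) (unique-⊆⇒length-≤ (allFin⁺ r) cover))
    where
    cover : allFin r ⊆ i ∷ j ∷ filter P? (allFin r)
    cover {ℓ} _ with ℓ ≟ i | ℓ ≟ j
    ... | yes ℓ≡i | _       = here ℓ≡i
    ... | no _    | yes ℓ≡j = there (here ℓ≡j)
    ... | no ℓ≢i  | no ℓ≢j  = there (there (∈-filter⁺ P? (∈-allFin ℓ) (holds ℓ ℓ≢i ℓ≢j)))

  holds-everywhere⇒r∸2≤count : (∀ ℓ → P ℓ) → r ∸ 2 ≤ count P?
  holds-everywhere⇒r∸2≤count holds = subst (r ∸ 2 ≤_) r≡count (m∸n≤m r 2)
    where
    r≡count : r ≡ count P?
    r≡count = trans (sym (length-allFin r))
                    (cong length (sym (filter-all P? (All.universal holds (allFin r)))))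

another : ∀ {m} → 2 ≤ m → (x : Fin m) → ∃[ y ] y ≢ x
another (s≤s (s≤s _)) F.zero    = F.suc F.zero , λ ()
another (s≤s (s≤s _)) (F.suc _) = F.zero , λ ()

others : ∀ {m} → Fin m → List (Fin m)
others {suc m} x = tabulate (punchIn x)

∈-others⁺ : ∀ {m} {x y : Fin m} → y ≢ x → y ∈ others x
∈-others⁺ {suc m} {x} y≢x = subst (_∈ others x) (punchIn-punchOut (≢-sym y≢x)) (∈-tabulate⁺ _)

∈-others⁻ : ∀ {m} {x y : Fin m} → y ∈ others x → y ≢ x
∈-others⁻ {suc m} {x} y∈ y≡x with ∈-tabulate⁻ y∈
... | v , y≡xᵥ = punchInᵢ≢i x v (trans (sym y≡xᵥ) y≡x)

others-unique : ∀ {m} (x : Fin m) → Unique (others x)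
others-unique {suc m} x = tabulate⁺ (punchIn-injective x _ _)

length-others : ∀ {m} (x : Fin m) → suc (length (others x)) ≡ m
length-others {suc m} x = cong suc (length-tabulate (punchIn x))

module _ {r : ℕ} {n : Fin r → ℕ} where

  infixl 30 _[_]≔_
  _[_]≔_ : Tuple r n → (k : Fin r) → Fin (n k) → Tuple r n
  (X [ k ]≔ x) ℓ with ℓ ≟ k
  ... | yes refl = x
  ... | no _     = X ℓ

  []≔-updates : ∀ X k x → (X [ k ]≔ x) k ≡ x
  []≔-updates X k x with k ≟ k
  ... | yes refl = refl
  ... | no k≢k   = ⊥-elim (k≢k refl)

  []≔-minimal : ∀ X k x {ℓ} → ℓ ≢ k → (X [ k ]≔ x) ℓ ≡ X ℓ
  []≔-minimal X k x {ℓ} ℓ≢k with ℓ ≟ k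
  ... | yes ℓ≡k = ⊥-elim (ℓ≢k ℓ≡k)
  ... | no _    = refl

  []≔-injective : ∀ X k {x y} → X [ k ]≔ x ≗ᵗ X [ k ]≔ y → x ≡ y
  []≔-injective X k {x} {y} eq = trans (sym ([]≔-updates X k x)) (trans (eq k) ([]≔-updates X k y))

  split-at : ∀ {q} {Q : Fin r → Set q} k → Q k → (∀ ℓ → ℓ ≢ k → Q ℓ) → ∀ ℓ → Q ℓ
  split-at k Qk Q-elsewhere ℓ with ℓ ≟ k
  ... | yes refl = Qk
  ... | no ℓ≢k   = Q-elsewhere ℓ ℓ≢k

  Neighbour : Tuple r n → Fin r → Tuple r n → Set
  Neighbour c k Z = Z k ≢ c k × (∀ ℓ → ℓ ≢ k → Z ℓ ≡ c ℓ)

  ≗ᵗ-setoid : Setoid _ _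
  ≗ᵗ-setoid = record
    { Carrier       = Tuple r n
    ; _≈_           = _≗ᵗ_
    ; isEquivalence = record
      { refl  = λ _ → refl
      ; sym   = λ X≗Y ℓ → sym (X≗Y ℓ)
      ; trans = λ X≗Y Y≗Z ℓ → trans (X≗Y ℓ) (Y≗Z ℓ)
      }
    }

  open SetoidMembership ≗ᵗ-setoid using () renaming (_∈_ to _∈ᵗ_; _∉_ to _∉ᵗ_)

  _≗ᵗ?_ : (X Y : Tuple r n) → Dec (X ≗ᵗ Y)
  X ≗ᵗ? Y = FinP.all? (λ ℓ → X ℓ ≟ Y ℓ)

  ∈⇒∈ᵗ : ∀ {Z xs} → Z ∈ xs → Z ∈ᵗ xs
  ∈⇒∈ᵗ = Any.map (λ { refl _ → refl })

  _∈ᵗ?_ : ∀ Z xs → Dec (Z ∈ᵗ xs)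
  Z ∈ᵗ? xs = Any.any? (Z ≗ᵗ?_) xs

  neighbours : Tuple r n → Fin r → List (Tuple r n)
  neighbours c k = map (c [ k ]≔_) (others (c k))

  sphere : Tuple r n → List (Tuple r n)
  sphere c = concat (map (neighbours c) (allFin r))

  Ball : Tuple r n → List (Tuple r n)
  Ball c = c ∷ sphere c

  ∈ᵗ-neighbours⁺ : ∀ {c k Z} → Neighbour c k Z → Z ∈ᵗ neighbours c k
  ∈ᵗ-neighbours⁺ {c} {k} {Z} (Zk≢ck , Z≡c) =
    Any.map (λ { refl → Z≗c[k]≔Zk }) (∈-map⁺ (c [ k ]≔_) (∈-others⁺ Zk≢ck))
    where
    Z≗c[k]≔Zk : Z ≗ᵗ c [ k ]≔ Z k
    Z≗c[k]≔Zk ℓ with ℓ ≟ k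
    ... | yes refl = refl
    ... | no ℓ≢k   = Z≡c ℓ ℓ≢k

  ∈ᵗ-neighbours⁻ : ∀ {c k Z} → Z ∈ᵗ neighbours c k → Neighbour c k Z
  ∈ᵗ-neighbours⁻ {c} {k} {Z} Z∈ with SetoidMembershipP.∈-map⁻ (≡.setoid _) ≗ᵗ-setoid Z∈
  ... | x , x∈others , Z≗c[k]≔x =
    (λ Zk≡ck → ∈-others⁻ x∈others (trans (sym (trans (Z≗c[k]≔x k) ([]≔-updates c k x))) Zk≡ck)) ,
    (λ ℓ ℓ≢k → trans (Z≗c[k]≔x ℓ) ([]≔-minimal c k x ℓ≢k))

  ∈ᵗ-sphere⁺ : ∀ {c k Z} → Neighbour c k Z → Z ∈ᵗ sphere c
  ∈ᵗ-sphere⁺ {k = k} Z-nb = AnyP.concat⁺ (AnyP.map⁺ (lose (∈-allFin k) (∈ᵗ-neighbours⁺ Z-nb)))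

  ∈ᵗ-sphere⁻ : ∀ {c Z} → Z ∈ᵗ sphere c → ∃[ k ] Neighbour c k Z
  ∈ᵗ-sphere⁻ {c} Z∈ with Any.satisfied (AnyP.map⁻ (AnyP.concat⁻ (map (neighbours c) (allFin r)) Z∈))
  ... | k , Z∈neighbours = k , ∈ᵗ-neighbours⁻ Z∈neighbours

  ∈-Ball⇒near : ∀ {c Z} → Z ∈ Ball c → Z ≗ᵗ c ⊎ ∃[ k ] Neighbour c k Z
  ∈-Ball⇒near (here refl) = inj₁ (λ _ → refl)
  ∈-Ball⇒near (there Z∈) = inj₂ (∈ᵗ-sphere⁻ (∈⇒∈ᵗ Z∈))

  ∉Ball⇒two-moves : ∀ {c Z} → Z ∉ᵗ Ball c → ∃₂ λ u v → u ≢ v × Z u ≢ c u × Z v ≢ c v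
  ∉Ball⇒two-moves {c} {Z} Z∉ with FinP.any? (λ u → ¬? (Z u ≟ c u))
  ... | no none = ⊥-elim (Z∉ (here (λ ℓ → decidable-stable (Z ℓ ≟ c ℓ) (λ Zℓ≢cℓ → none (ℓ , Zℓ≢cℓ)))))
  ... | yes (u , Zu≢cu) with FinP.any? (λ v → ¬? (v ≟ u) ×-dec ¬? (Z v ≟ c v))
  ...   | yes (v , v≢u , Zv≢cv) = u , v , ≢-sym v≢u , Zu≢cu , Zv≢cv
  ...   | no none = ⊥-elim (Z∉ (there (∈ᵗ-sphere⁺ (Zu≢cu , fixed))))
    where
    fixed : ∀ ℓ → ℓ ≢ u → Z ℓ ≡ c ℓ
    fixed ℓ ℓ≢u = decidable-stable (Z ℓ ≟ c ℓ) (λ Zℓ≢cℓ → none (ℓ , ℓ≢u , Zℓ≢cℓ))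

  Ball-unique : ∀ c → NoDup (Ball c)
  Ball-unique c = All.tabulate c∉sphere ∷ UniqueSP.concat⁺ ≗ᵗ-setoid neighbours-unique disjoint
    where
    c∉sphere : ∀ {Y} → Y ∈ sphere c → ¬ c ≗ᵗ Y
    c∉sphere Y∈ c≗Y with ∈ᵗ-sphere⁻ (∈⇒∈ᵗ Y∈)
    ... | k , Yk≢ck , _ = Yk≢ck (sym (c≗Y k))
    neighbours-unique : All (UniqueS.Unique ≗ᵗ-setoid) (map (neighbours c) (allFin r))
    neighbours-unique = AllP.map⁺ (All.universal (λ k →
      UniqueSP.map⁺ (≡.setoid _) ≗ᵗ-setoid ([]≔-injective c k) (others-unique (c k))) _)
    disjoint : AllPairs (DisjointS.Disjoint ≗ᵗ-setoid) (map (neighbours c) (allFin r))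
    disjoint = AllPairsP.map⁺ (AllPairsP.tabulate⁺ λ {k} {k′} k≢k′ (Z∈k , Z∈k′) →
      proj₁ (∈ᵗ-neighbours⁻ Z∈k) (proj₂ (∈ᵗ-neighbours⁻ Z∈k′) k k≢k′))

  length-neighbours : ∀ c k → suc (length (neighbours c k)) ≡ n k
  length-neighbours c k = trans (cong suc (length-map (c [ k ]≔_) (others (c k)))) (length-others (c k))

  length-spheres : ∀ c ks → length ks + length (concat (map (neighbours c) ks)) ≡ sum (map n ks)
  length-spheres c []       = refl
  length-spheres c (k ∷ ks) = begin
    suc (length ks + length (nb ++ rest))
      ≡⟨ cong (suc ∘ (length ks +_)) (length-++ nb) ⟩
    suc (length ks + (length nb + length rest))
      ≡⟨ cong suc (x∙yz≈y∙xz +-commutativeSemigroup (length ks) (length nb) (length rest)) ⟩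
    suc (length nb) + (length ks + length rest)
      ≡⟨ cong₂ _+_ (length-neighbours c k) (length-spheres c ks) ⟩
    n k + sum (map n ks)
      ∎
    where
    open ≡-Reasoning
    nb = neighbours c k
    rest = concat (map (neighbours c) ks)

  length-Ball : ∀ c → length (Ball c) ≡ sumFin n ∸ r + 1
  length-Ball c = begin
    suc (length (sphere c))              ≡⟨ +-comm 1 _ ⟩
    length (sphere c) + 1                ≡⟨ cong (_+ 1) (sym (m+n∸m≡n r _)) ⟩
    r + length (sphere c) ∸ r + 1        ≡⟨ cong (λ m → m ∸ r + 1) r+∣sphere∣≡Σn ⟩
    sumFin n ∸ r + 1                     ∎
    where
    open ≡-Reasoning
    r+∣sphere∣≡Σn : r + length (sphere c) ≡ sumFin n
    r+∣sphere∣≡Σn = trans (cong (_+ length (sphere c)) (sym (length-allFin r)))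
                          (length-spheres c (allFin r))

  Ball-intersecting : ∀ c → TIntersecting (r ∸ 2) (Ball c)
  Ball-intersecting c {X} {Y} X∈ Y∈ with ∈-Ball⇒near X∈ | ∈-Ball⇒near Y∈
  ... | inj₁ X≗c | inj₁ Y≗c =
    holds-everywhere⇒r∸2≤count (λ ℓ → X ℓ ≟ Y ℓ) (λ ℓ → trans (X≗c ℓ) (sym (Y≗c ℓ)))
  ... | inj₁ X≗c | inj₂ (k , _ , Y≡c) =
    holds-off-two⇒r∸2≤count (λ ℓ → X ℓ ≟ Y ℓ) k k (λ ℓ ℓ≢k _ → trans (X≗c ℓ) (sym (Y≡c ℓ ℓ≢k)))
  ... | inj₂ (k , _ , X≡c) | inj₁ Y≗c =
    holds-off-two⇒r∸2≤count (λ ℓ → X ℓ ≟ Y ℓ) k k (λ ℓ ℓ≢k _ → trans (X≡c ℓ ℓ≢k) (sym (Y≗c ℓ)))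
  ... | inj₂ (k , _ , X≡c) | inj₂ (k′ , _ , Y≡c) =
    holds-off-two⇒r∸2≤count (λ ℓ → X ℓ ≟ Y ℓ) k k′ (λ ℓ ℓ≢k ℓ≢k′ → trans (X≡c ℓ ℓ≢k) (sym (Y≡c ℓ ℓ≢k′)))

  Constant : Family r n → Fin r → Set
  Constant F ℓ = All (λ A → All (λ B → A ℓ ≡ B ℓ) F) F

  nowhere-constant⇒kernelSize≡0 : ∀ {F} → (∀ ℓ → ¬ Constant F ℓ) → kernelSize F ≡ 0
  nowhere-constant⇒kernelSize≡0 nowhere = cong length (filter-none _ (All.universal nowhere (allFin r)))

  Ball-admissible : 3 ≤ r → (∀ ℓ → 2 ≤ n ℓ) → ∀ c → Admissible (r ∸ 2) (Ball c)
  Ball-admissible 3≤r 2≤n c =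
    Ball-unique c , Ball-intersecting c ,
    subst (_< r ∸ 2) (sym (nowhere-constant⇒kernelSize≡0 moving)) (∸-monoˡ-≤ 2 3≤r)
    where
    moving : ∀ ℓ → ¬ Constant (Ball c) ℓ
    moving ℓ constant with another (2≤n ℓ) (c ℓ)
    ... | y , y≢cℓ = y≢cℓ (sym (trans cℓ≡c[ℓ]≔y ([]≔-updates c ℓ y)))
      where
      c[ℓ]≔y∈ : c [ ℓ ]≔ y ∈ sphere c
      c[ℓ]≔y∈ = ∈-concat⁺′ (∈-map⁺ (c [ ℓ ]≔_) (∈-others⁺ y≢cℓ)) (∈-map⁺ (neighbours c) (∈-allFin ℓ))
      cℓ≡c[ℓ]≔y : c ℓ ≡ (c [ ℓ ]≔ y) ℓ
      cℓ≡c[ℓ]≔y = All.lookup (All.lookup constant (here refl)) (there c[ℓ]≔y∈)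

  -- These fields make pull c, which exchanges the member outside Ball c for c,
  -- injective on F.
  record EmbedsInBall (c : Tuple r n) (F : Family r n) : Set where
    field
      outliers-equal  : ∀ {Z Z′} → Z ∈ F → Z′ ∈ F → Z ∉ᵗ Ball c → Z′ ∉ᵗ Ball c → Z ≗ᵗ Z′
      outlier⇒centre∉ : ∀ {Z Y} → Z ∈ F → Y ∈ F → Z ∉ᵗ Ball c → ¬ Y ≗ᵗ c

  pull : Tuple r n → Tuple r n → Tuple r n
  pull c Z with Z ∈ᵗ? Ball c
  ... | yes _ = Z
  ... | no _  = c

  pull-∈ : ∀ c Z → pull c Z ∈ᵗ Ball c
  pull-∈ c Z with Z ∈ᵗ? Ball c
  ... | yes Z∈ = Z∈
  ... | no _   = here (λ _ → refl)

  embeds-in-ball⇒length-≤ : ∀ {c F} → NoDup F → EmbedsInBall c F → length F ≤ length (Ball c)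
  embeds-in-ball⇒length-≤ {c} {F} F-unique embeds =
    injective-on⇒length-≤ ≗ᵗ-setoid (pull c) F-unique injective (λ {Z} _ → pull-∈ c Z)
    where
    open EmbedsInBall embeds
    injective : ∀ {Z Z′} → Z ∈ F → Z′ ∈ F → pull c Z ≗ᵗ pull c Z′ → Z ≗ᵗ Z′
    injective {Z} {Z′} Z∈F Z′∈F eq with Z ∈ᵗ? Ball c | Z′ ∈ᵗ? Ball c
    ... | yes _  | yes _   = eq
    ... | yes _  | no Z′∉  = ⊥-elim (outlier⇒centre∉ Z′∈F Z∈F Z′∉ eq)
    ... | no Z∉  | yes _   = ⊥-elim (outlier⇒centre∉ Z∈F Z′∈F Z∉ (λ ℓ → sym (eq ℓ)))
    ... | no Z∉  | no Z′∉  = outliers-equal Z∈F Z′∈F Z∉ Z′∉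

  Spoke : Family r n → Tuple r n → Fin r → Set
  Spoke F P a = ∃[ X ] X ∈ F × Neighbour P a X

  record Tripod (F : Family r n) (P : Tuple r n) : Set where
    constructor tripod
    field
      {i j k} : Fin r
      i≢j     : i ≢ j
      j≢k     : j ≢ k
      k≢i     : k ≢ i
      spokeᵢ  : Spoke F P i
      spokeⱼ  : Spoke F P j
      spokeₖ  : Spoke F P k

  rotate : ∀ {F P} → Tripod F P → Tripod F P
  rotate (tripod i≢j j≢k k≢i sᵢ sⱼ sₖ) = tripod j≢k k≢i i≢j sⱼ sₖ sᵢ

  small-kernel⇒moved-off-two : ∀ {F A} → kernelSize F < r ∸ 2 → A ∈ F → ∀ i j →
                               ∃₂ λ k W → k ≢ i × k ≢ j × W ∈ F × W k ≢ A k
  small-kernel⇒moved-off-two {F} {A} κ A∈F i j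
    with FinP.any? (λ k → ¬? (k ≟ i) ×-dec ¬? (k ≟ j) ×-dec Any.any? (λ W → ¬? (W k ≟ A k)) F)
  ... | yes (k , k≢i , k≢j , moved) = let W , W∈F , Wk≢Ak = find moved in k , W , k≢i , k≢j , W∈F , Wk≢Ak
  ... | no none = ⊥-elim (<⇒≱ κ (holds-off-two⇒r∸2≤count _ i j constant))
    where
    constant : ∀ ℓ → ℓ ≢ i → ℓ ≢ j → Constant F ℓ
    constant ℓ ℓ≢i ℓ≢j = All.tabulate λ X∈F → All.tabulate λ Y∈F → trans (at-A X∈F) (sym (at-A Y∈F))
      where
      at-A : ∀ {X} → X ∈ F → X ℓ ≡ A ℓ
      at-A {X} X∈F = decidable-stable (X ℓ ≟ A ℓ) λ Xℓ≢Aℓ → none (ℓ , ℓ≢i , ℓ≢j , lose X∈F Xℓ≢Aℓ)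

  module _ {F : Family r n} (F-int : TIntersecting (r ∸ 2) F) where

    agree-off-two : ∀ {X Y u v} → X ∈ F → Y ∈ F → u ≢ v → X u ≢ Y u → X v ≢ Y v →
                    ∀ ℓ → ℓ ≢ u → ℓ ≢ v → X ℓ ≡ Y ℓ
    agree-off-two {X} {Y} X∈F Y∈F u≢v Xu≢Yu Xv≢Yv ℓ ℓ≢u ℓ≢v =
      decidable-stable (X ℓ ≟ Y ℓ) λ Xℓ≢Yℓ → ≤⇒≯ (F-int X∈F Y∈F) (∸-monoˡ-≤ 2
        (three-failures⇒3+count≤r (λ ℓ → X ℓ ≟ Y ℓ) u≢v (≢-sym ℓ≢u) (≢-sym ℓ≢v) Xu≢Yu Xv≢Yv Xℓ≢Yℓ))

    agrees-with-neighbour : ∀ {P X Z a b c} → X ∈ F → Neighbour P a X → Z ∈ F → b ≢ c → b ≢ a → c ≢ a →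
                            Z b ≢ P b → Z c ≢ P c → ∀ ℓ → ℓ ≢ b → ℓ ≢ c → Z ℓ ≡ X ℓ
    agrees-with-neighbour {Z = Z} X∈F (_ , X≡P) Z∈F b≢c b≢a c≢a Zb≢Pb Zc≢Pc =
      agree-off-two Z∈F X∈F b≢c (subst (Z _ ≢_) (sym (X≡P _ b≢a)) Zb≢Pb)
                                (subst (Z _ ≢_) (sym (X≡P _ c≢a)) Zc≢Pc)

    outlier-moves-along : ∀ {P s Z} → Spoke F P s → Z ∈ F → Z ∉ᵗ Ball P → Z s ≢ P s
    outlier-moves-along {P} {s} {Z} (X , X∈F , Xs≢Ps , X≡P) Z∈F Z∉ Zs≡Ps with ∉Ball⇒two-moves Z∉
    ... | u , v , u≢v , Zu≢Pu , Zv≢Pv = Xs≢Ps (trans (sym Zs≡Xs) Zs≡Ps)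
      where
      s≢u : s ≢ u
      s≢u refl = Zu≢Pu Zs≡Ps
      s≢v : s ≢ v
      s≢v refl = Zv≢Pv Zs≡Ps
      Zs≡Xs : Z s ≡ X s
      Zs≡Xs = agrees-with-neighbour X∈F (Xs≢Ps , X≡P) Z∈F u≢v (≢-sym s≢u) (≢-sym s≢v)
                                    Zu≢Pu Zv≢Pv s s≢u s≢v

    outliers-agree-off : ∀ {P} (t : Tripod F P) → let open Tripod t in
                         ∀ {Z Z′} → Z ∈ F → Z′ ∈ F → Z ∉ᵗ Ball P → Z′ ∉ᵗ Ball P →
                         ∀ ℓ → ℓ ≢ j → ℓ ≢ k → Z ℓ ≡ Z′ ℓ
    outliers-agree-off {P} (tripod i≢j j≢k k≢i (X , X∈F , X-nb) sⱼ sₖ) Z∈F Z′∈F Z∉ Z′∉ ℓ ℓ≢j ℓ≢k =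
      trans (agrees Z∈F Z∉) (sym (agrees Z′∈F Z′∉))
      where
      agrees : ∀ {Z} → Z ∈ F → Z ∉ᵗ Ball P → Z ℓ ≡ X ℓ
      agrees Z∈F Z∉ = agrees-with-neighbour X∈F X-nb Z∈F j≢k (≢-sym i≢j) k≢i
        (outlier-moves-along sⱼ Z∈F Z∉) (outlier-moves-along sₖ Z∈F Z∉) ℓ ℓ≢j ℓ≢k

    tripod⇒embeds-in-ball : ∀ {P} → Tripod F P → EmbedsInBall P F
    tripod⇒embeds-in-ball {P} t = record { outliers-equal = outliers-equal ; outlier⇒centre∉ = centre∉ }
      where
      open Tripod t
      outliers-equal : ∀ {Z Z′} → Z ∈ F → Z′ ∈ F → Z ∉ᵗ Ball P → Z′ ∉ᵗ Ball P → Z ≗ᵗ Z′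
      outliers-equal Z∈F Z′∈F Z∉ Z′∉ ℓ with ℓ ≟ j | ℓ ≟ k
      ... | no ℓ≢j  | no ℓ≢k  = outliers-agree-off t Z∈F Z′∈F Z∉ Z′∉ ℓ ℓ≢j ℓ≢k
      ... | yes refl | _       = outliers-agree-off (rotate t) Z∈F Z′∈F Z∉ Z′∉ ℓ j≢k (≢-sym i≢j)
      ... | no _    | yes refl = outliers-agree-off (rotate (rotate t)) Z∈F Z′∈F Z∉ Z′∉ ℓ k≢i (≢-sym j≢k)
      centre∉ : ∀ {Z Y} → Z ∈ F → Y ∈ F → Z ∉ᵗ Ball P → ¬ Y ≗ᵗ P
      centre∉ {Z} {Y} Z∈F Y∈F Z∉ Y≗P =
        moves spokeₖ (trans Zk≡Yk (Y≗P k))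
        where
        moves : ∀ {s} → Spoke F P s → Z s ≢ P s
        moves spoke = outlier-moves-along spoke Z∈F Z∉
        away : ∀ {s} → Spoke F P s → Z s ≢ Y s
        away {s} spoke = subst (Z s ≢_) (sym (Y≗P s)) (moves spoke)
        Zk≡Yk : Z k ≡ Y k
        Zk≡Yk = agree-off-two Z∈F Y∈F i≢j (away spokeᵢ) (away spokeⱼ) k k≢i (≢-sym j≢k)

    tripod-at-corner : ∀ {A B W i j k} → A ∈ F → B ∈ F → W ∈ F → i ≢ j → k ≢ i → k ≢ j →
                       B i ≢ A i → B j ≢ A j → W k ≢ A k → W i ≡ A i → Tripod F (A [ j ]≔ B j)
    tripod-at-corner {A} {B} {W} {i} {j} {k} A∈F B∈F W∈F i≢j k≢i k≢j Bi≢Ai Bj≢Aj Wk≢Ak Wi≡Ai =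
      tripod (≢-sym i≢j) (≢-sym k≢i) k≢j (A , A∈F , A-nb) (B , B∈F , B-nb) (W , W∈F , W-nb)
      where
      P = A [ j ]≔ B j
      Pj≡Bj : P j ≡ B j
      Pj≡Bj = []≔-updates A j (B j)
      Pℓ≡Aℓ : ∀ {ℓ} → ℓ ≢ j → P ℓ ≡ A ℓ
      Pℓ≡Aℓ = []≔-minimal A j (B j)
      B≡A : ∀ ℓ → ℓ ≢ i → ℓ ≢ j → B ℓ ≡ A ℓ
      B≡A = agree-off-two B∈F A∈F i≢j Bi≢Ai Bj≢Aj
      Wj≡Bj : W j ≡ B j
      Wj≡Bj = agree-off-two W∈F B∈F (≢-sym k≢i) (λ Wi≡Bi → Bi≢Ai (trans (sym Wi≡Bi) Wi≡Ai))
                (subst (W k ≢_) (sym (B≡A k k≢i k≢j)) Wk≢Ak) j (≢-sym i≢j) (≢-sym k≢j)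
      W≡A : ∀ ℓ → ℓ ≢ j → ℓ ≢ k → W ℓ ≡ A ℓ
      W≡A = agree-off-two W∈F A∈F (≢-sym k≢j) (subst (_≢ A j) (sym Wj≡Bj) Bj≢Aj) Wk≢Ak
      A-nb : Neighbour P j A
      A-nb = subst (A j ≢_) (sym Pj≡Bj) (≢-sym Bj≢Aj) , λ ℓ ℓ≢j → sym (Pℓ≡Aℓ ℓ≢j)
      B-nb : Neighbour P i B
      B-nb = subst (B i ≢_) (sym (Pℓ≡Aℓ i≢j)) Bi≢Ai ,
        split-at j (λ _ → sym Pj≡Bj) (λ ℓ ℓ≢j ℓ≢i → trans (B≡A ℓ ℓ≢i ℓ≢j) (sym (Pℓ≡Aℓ ℓ≢j)))
      W-nb : Neighbour P k W
      W-nb = subst (W k ≢_) (sym (Pℓ≡Aℓ k≢j)) Wk≢Ak ,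
        split-at i (λ _ → trans Wi≡Ai (sym (Pℓ≡Aℓ i≢j)))
          (split-at j (λ _ _ → trans Wj≡Bj (sym Pj≡Bj))
            (λ ℓ ℓ≢j _ ℓ≢k → trans (W≡A ℓ ℓ≢j ℓ≢k) (sym (Pℓ≡Aℓ ℓ≢j))))

    tripod-beside-outlier : ∀ {A B} → kernelSize F < r ∸ 2 → A ∈ F → B ∈ F → B ∉ᵗ Ball A →
                            ∃[ P ] Tripod F P
    tripod-beside-outlier {A} {B} κ A∈F B∈F B∉ with ∉Ball⇒two-moves B∉
    ... | i , j , i≢j , Bi≢Ai , Bj≢Aj with small-kernel⇒moved-off-two κ A∈F i j
    ...   | k , W , k≢i , k≢j , W∈F , Wk≢Ak with W i ≟ A i
    ...     | yes Wi≡Ai = _ , tripod-at-corner A∈F B∈F W∈F i≢j k≢i k≢j Bi≢Ai Bj≢Aj Wk≢Ak Wi≡Ai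
    ...     | no Wi≢Ai  = _ , tripod-at-corner B∈F A∈F W∈F i≢j k≢i k≢j
                                (≢-sym Bi≢Ai) (≢-sym Bj≢Aj) Wk≢Bk Wi≡Bi
      where
      Wk≢Bk : W k ≢ B k
      Wk≢Bk = subst (W k ≢_) (sym (agree-off-two B∈F A∈F i≢j Bi≢Ai Bj≢Aj k k≢i k≢j)) Wk≢Ak
      Wj≡Aj : W j ≡ A j
      Wj≡Aj = agree-off-two W∈F A∈F (≢-sym k≢i) Wi≢Ai Wk≢Ak j (≢-sym i≢j) (≢-sym k≢j)
      Wi≡Bi : W i ≡ B i
      Wi≡Bi = agree-off-two W∈F B∈F (≢-sym k≢j) (subst (_≢ B j) (sym Wj≡Aj) (≢-sym Bj≢Aj)) Wk≢Bk
                            i i≢j (≢-sym k≢i)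

    embeds-in-some-ball : kernelSize F < r ∸ 2 → ∀ {A} → A ∈ F → ∃[ c ] EmbedsInBall c F
    embeds-in-some-ball κ {A} A∈F with Any.any? (λ Z → ¬? (Z ∈ᵗ? Ball A)) F
    ... | no none = A , record
      { outliers-equal  = λ Z∈F _ Z∉ _ → ⊥-elim (none (lose Z∈F Z∉))
      ; outlier⇒centre∉ = λ Z∈F _ Z∉ _ → ⊥-elim (none (lose Z∈F Z∉))
      }
    ... | yes outside with find outside
    ...   | B , B∈F , B∉ with tripod-beside-outlier κ A∈F B∈F B∉
    ...     | P , t = P , tripod⇒embeds-in-ball t

  admissible⇒length-≤ : ∀ {F : Family r n} → Admissible (r ∸ 2) F → length F ≤ sumFin n ∸ r + 1
  admissible⇒length-≤ {[]} _ = z≤n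
  admissible⇒length-≤ {A ∷ F} (F-unique , F-int , κ) with embeds-in-some-ball F-int κ (here refl)
  ... | c , embeds = subst (length (A ∷ F) ≤_) (length-Ball c) (embeds-in-ball⇒length-≤ F-unique embeds)

theorem1p11 : (r : ℕ) → 3 ≤ r → (n : Fin r → ℕ)
    → (∀ (i j : Fin r) → i F.≤ j → n j ≤ n i)
    → (∀ (i : Fin r) → 2 ≤ n i)
    → IsIota0 (r ∸ 2) r n (sumFin n ∸ r + 1)
theorem1p11 r 3≤r n _ 2≤n =
  (Ball c , Ball-admissible 3≤r 2≤n c , length-Ball c) , λ F → admissible⇒length-≤
  where
  c : Tuple r n
  c ℓ = fromℕ< (2≤n ℓ)
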